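{- Let $n \in \mathbb{N}$ and let $\mathcal{F} \subseteq \mathcal{P}([n])$ be a union closed family with $\emptyset \in \mathcal{F}$. Define $\tau(X) = \bigcup\{F \in \mathcal{F} : F \subseteq X\}$ for $X \subseteq [n]$, and $\mathcal{T}(F) = \{X \subseteq [n] : \tau(X) = F\}$ for $F \in \mathcal{F}$. Then the sets of $\mathcal{F}$ can be labeled $\mathcal{F} = \{F_1, \dots, F_m\}$ in such a way that (i) $\#\mathcal{T}(F_1) \leq \#\mathcal{T}(F_2) \leq \dots \leq \#\mathcal{T}(F_m)$, and (ii) whenever $F_i \supseteq F_j$ then $i \leq j$.
   Context: $[n] = \{1,\dots,n\}$, $\mathcal{P}([n])$ its power set, $\#X$ the cardinality. A family is union closed if $A, B \in \mathcal{F}$ implies $A \cup B \in \mathcal{F}$. -}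

module Defs where

open import Data.Nat using (ℕ; zero; suc)
open import Data.Bool using (Bool)
open import Data.Bool.Properties renaming (_≟_ to _≟ᵇ_)
open import Data.Fin.Subset using (Subset; _⊆_; _∪_; ⋃; inside; outside)
open import Data.Fin.Subset.Properties using (_⊆?_)
open import Data.Vec using (Vec; []; _∷_)
open import Data.Vec.Properties using (≡-dec)
open import Data.List using (List; []; _∷_; [_]; map; _++_; filter; length)
open import Data.List.Membership.Propositional using (_∈_)
open import Relation.Binary.Definitions using (DecidableEquality)

_≟ₛ_ : ∀ {n} → DecidableEquality (Subset n)
_≟ₛ_ = ≡-dec _≟ᵇ_

allSubsets : (n : ℕ) → List (Subset n)
allSubsets zero    = [ [] ]
allSubsets (suc n) = map (outside ∷_) (allSubsets n) ++ map (inside ∷_) (allSubsets n)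

-- A family 𝓕 ⊆ P([n]) is given by a list of its members (membership = list membership).
UnionClosed : ∀ {n} → List (Subset n) → Set
UnionClosed 𝓕 = ∀ A B → A ∈ 𝓕 → B ∈ 𝓕 → (A ∪ B) ∈ 𝓕

τ : ∀ {n} → List (Subset n) → Subset n → Subset n
τ 𝓕 X = ⋃ (filter (_⊆? X) 𝓕)

#𝓣 : ∀ {n} → List (Subset n) → Subset n → ℕ
#𝓣 {n} 𝓕 F = length (filter (λ X → τ 𝓕 X ≟ₛ F) (allSubsets n))

{-# OPTIONS --safe #-}
-- If F ∈ 𝓕 and F ⊆ G, the involution X ↦ X Δ (G ∖ F) of P([n]) maps 𝓣(G) into 𝓣(F):
-- τ(X) = G forces G ⊆ X, and replacing G by F inside X gives X' ⊆ X with X' ∩ G = F, whence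
-- F ⊆ τ(X') ⊆ τ(X) ∩ X' = F. So #𝓣 is antitone on 𝓕, and sorting 𝓕 by increasing #𝓣, ties
-- broken by decreasing cardinality, puts every superset before its subsets.
module Submission where

open import Defs
open import Data.Bool using (true; false; _xor_; _∧_; b≤b; f≤t) renaming (_≤_ to _≤ᵇ_)
open import Data.Bool.Properties using (≤-minimum)
open import Data.Empty using (⊥-elim)
open import Data.Fin using (Fin; zero; suc) renaming (_≤_ to _≤ᶠ_; _<_ to _<ᶠ_)
import Data.Fin.Properties as Finₚ
open import Data.Fin.Subset using (Subset; _⊆_; _∩_; ⋃; ∣_∣; inside; outside; ⊥)
open import Data.Fin.Subset.Properties
  using (_⊆?_; ∉⊥; x∈p∪q⁻; p⊆p∪q; q⊆p∪q; x∈p∩q⁺; ⊆-trans; ⊆-antisym; drop-∷-⊆; p⊆q⇒∣p∣≤∣q∣)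
open import Data.List using (List; []; _∷_; map; _++_; filter; length; lookup; deduplicate)
open import Data.List.Properties using (map-++; map-∘)
open import Data.List.Membership.Propositional using (_∈_)
open import Data.List.Membership.Propositional.Properties
  using (∈-filter⁺; ∈-filter⁻; ∈-deduplicate⁺; ∈-deduplicate⁻; ∈-lookup)
open import Data.List.Relation.Unary.Any using (here; there)
open import Data.List.Relation.Unary.AllPairs using (_∷_)
import Data.List.Relation.Unary.All as All
open import Data.List.Relation.Unary.Unique.Propositional using (Unique)
open import Data.List.Relation.Unary.Unique.DecPropositional.Properties using (deduplicate-!)
open import Data.List.Relation.Binary.Permutation.Propositional
  using (_↭_; ↭-refl; ↭-sym; ↭⇒↭ₛ; module PermutationReasoning)
open import Data.List.Relation.Binary.Permutation.Propositional.Properties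
  using (∈-resp-↭; ↭-length; filter-↭; map⁺; ++⁺; ++-comm)
import Data.List.Relation.Binary.Permutation.Setoid.Properties as Permutationₛ
import Data.List.Sort as Sort
open import Data.List.Relation.Unary.Sorted.TotalOrder.Properties using (lookup-mono-≤)
open import Data.Nat using (ℕ; suc; _≤_; z≤n; s≤s)
open import Data.Nat.Properties
  using (≤-decTotalOrder; ≰⇒>; <⇒≤; ≤-reflexive; ≤-trans; ≤-antisym; m≤n⇒m≤1+n; <-irrefl)
open import Data.Product using (Σ; _×_; _,_; proj₂)
open import Data.Product.Relation.Binary.Lex.NonStrict using (×-decTotalOrder)
open import Data.Sum using (inj₁; inj₂)
open import Data.Vec using ([]; _∷_; here; there; zipWith) renaming (lookup to lookupᵛ)
open import Data.Vec.Properties using (lookup-zipWith)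
open import Function using (_∘_)
open import Function.Bundles using (_⇔_; mk⇔; Equivalence)
open import Level using (Level)
open import Relation.Binary.Bundles using (DecTotalOrder)
open import Relation.Binary.Definitions using (DecidableEquality)
import Relation.Binary.Construct.On as On
import Relation.Binary.Construct.Flip.EqAndOrd as Flip
open import Relation.Binary.PropositionalEquality
open import Relation.Nullary using (yes; no; ¬_; contradiction)
open import Relation.Unary using (Pred; Decidable)

private
  variable
    a b ℓ₁ ℓ₂ : Level
    A : Set a
    B : Set b
    n : ℕ

length-filter-map-≤ : ∀ {p q} {P : Pred A p} {Q : Pred B q} (P? : Decidable P) (Q? : Decidable Q)
  (f : A → B) → (∀ {x} → P x → Q (f x)) →
  ∀ xs → length (filter P? xs) ≤ length (filter Q? (map f xs))
length-filter-map-≤ P? Q? f P⇒Qf [] = z≤n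
length-filter-map-≤ P? Q? f P⇒Qf (x ∷ xs) with P? x | Q? (f x)
... | yes _  | yes _   = s≤s (length-filter-map-≤ P? Q? f P⇒Qf xs)
... | yes px | no ¬qfx = contradiction (P⇒Qf px) ¬qfx
... | no _   | yes _   = m≤n⇒m≤1+n (length-filter-map-≤ P? Q? f P⇒Qf xs)
... | no _   | no _    = length-filter-map-≤ P? Q? f P⇒Qf xs

length-filter-≤-↭ : ∀ {p q} {P : Pred A p} {Q : Pred A q} (P? : Decidable P) (Q? : Decidable Q)
  (f : A → A) {xs : List A} → map f xs ↭ xs → (∀ {x} → P x → Q (f x)) →
  length (filter P? xs) ≤ length (filter Q? xs)
length-filter-≤-↭ P? Q? f {xs} fxs↭xs P⇒Qf =
  ≤-trans (length-filter-map-≤ P? Q? f P⇒Qf xs) (≤-reflexive (↭-length (filter-↭ Q? fxs↭xs)))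

infixr 7 _⊕_

_⊕_ : Subset n → Subset n → Subset n
_⊕_ = zipWith _xor_

map-⊕-∷ : ∀ b c (d : Subset n) xs →
  map ((b ∷ d) ⊕_) (map (c ∷_) xs) ≡ map ((b xor c) ∷_) (map (d ⊕_) xs)
map-⊕-∷ b c d xs = trans (sym (map-∘ xs)) (map-∘ xs)

map-⊕-↭ : (d : Subset n) → map (d ⊕_) (allSubsets n) ↭ allSubsets n
map-⊕-↭ [] = ↭-refl
map-⊕-↭ {suc n} (b ∷ d) = begin
    map ((b ∷ d) ⊕_) (map (outside ∷_) S ++ map (inside ∷_) S)
  ≡⟨ map-++ _ (map (outside ∷_) S) _ ⟩
    map ((b ∷ d) ⊕_) (map (outside ∷_) S) ++ map ((b ∷ d) ⊕_) (map (inside ∷_) S)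
  ≡⟨ cong₂ _++_ (map-⊕-∷ b false d S) (map-⊕-∷ b true d S) ⟩
    map ((b xor false) ∷_) (map (d ⊕_) S) ++ map ((b xor true) ∷_) (map (d ⊕_) S)
  ↭⟨ ++⁺ (map⁺ _ (map-⊕-↭ d)) (map⁺ _ (map-⊕-↭ d)) ⟩
    map ((b xor false) ∷_) S ++ map ((b xor true) ∷_) S
  ↭⟨ halves b ⟩
    allSubsets (suc n) ∎
  where
  open PermutationReasoning
  S : List (Subset n)
  S = allSubsets n
  halves : ∀ b → map ((b xor false) ∷_) S ++ map ((b xor true) ∷_) S ↭ allSubsets (suc n)
  halves false = ↭-refl
  halves true  = ++-comm (map (inside ∷_) S) (map (outside ∷_) S)

⊆⇒lookup-≤ : {p q : Subset n} → p ⊆ q → ∀ i → lookupᵛ p i ≤ᵇ lookupᵛ q i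
⊆⇒lookup-≤ {p = outside ∷ _} _ zero = ≤-minimum _
⊆⇒lookup-≤ {p = inside ∷ _} p⊆q zero with p⊆q here
... | here = b≤b
⊆⇒lookup-≤ {p = _ ∷ _} {_ ∷ _} p⊆q (suc i) = ⊆⇒lookup-≤ (drop-∷-⊆ p⊆q) i

lookup-≤⇒⊆ : {p q : Subset n} → (∀ i → lookupᵛ p i ≤ᵇ lookupᵛ q i) → p ⊆ q
lookup-≤⇒⊆ {q = inside ∷ _} p≤q here = here
lookup-≤⇒⊆ {q = outside ∷ _} p≤q here with p≤q zero
... | ()
lookup-≤⇒⊆ {q = _ ∷ _} p≤q (there i∈p) = there (lookup-≤⇒⊆ (p≤q ∘ suc) i∈p)

xor-≤ʳ : ∀ {f g y} → f ≤ᵇ g → g ≤ᵇ y → (g xor f) xor y ≤ᵇ y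
xor-≤ʳ {false} {true}  f≤t b≤b = f≤t
xor-≤ʳ {false} {false} b≤b _   = b≤b
xor-≤ʳ {true}  {true}  b≤b b≤b = b≤b

≤-xor : ∀ {f g y} → f ≤ᵇ g → g ≤ᵇ y → f ≤ᵇ (g xor f) xor y
≤-xor {false} {true}  f≤t b≤b = b≤b
≤-xor {false} {false} b≤b _   = ≤-minimum _
≤-xor {true}  {true}  b≤b b≤b = b≤b

∧-xor-≤ : ∀ {f g y} → f ≤ᵇ g → g ≤ᵇ y → g ∧ ((g xor f) xor y) ≤ᵇ f
∧-xor-≤ {false} {true}  f≤t b≤b = b≤b
∧-xor-≤ {false} {false} b≤b _   = b≤b
∧-xor-≤ {true}  {true}  b≤b b≤b = b≤b

-- For F ⊆ G ⊆ Y, the set (G ⊕ F) ⊕ Y is Y with G replaced by F.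
module _ {F G Y : Subset n} (F⊆G : F ⊆ G) (G⊆Y : G ⊆ Y) where

  private
    lookup-⊕-⊕ : ∀ i → lookupᵛ ((G ⊕ F) ⊕ Y) i ≡ (lookupᵛ G i xor lookupᵛ F i) xor lookupᵛ Y i
    lookup-⊕-⊕ i =
      trans (lookup-zipWith _xor_ i (G ⊕ F) Y) (cong (_xor lookupᵛ Y i) (lookup-zipWith _xor_ i G F))

    F≤G : ∀ i → lookupᵛ F i ≤ᵇ lookupᵛ G i
    F≤G = ⊆⇒lookup-≤ F⊆G

    G≤Y : ∀ i → lookupᵛ G i ≤ᵇ lookupᵛ Y i
    G≤Y = ⊆⇒lookup-≤ G⊆Y

  ⊕-⊆ʳ : (G ⊕ F) ⊕ Y ⊆ Y
  ⊕-⊆ʳ = lookup-≤⇒⊆ λ i → subst (_≤ᵇ _) (sym (lookup-⊕-⊕ i)) (xor-≤ʳ (F≤G i) (G≤Y i))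

  ⊆-⊕ : F ⊆ (G ⊕ F) ⊕ Y
  ⊆-⊕ = lookup-≤⇒⊆ λ i → subst (_ ≤ᵇ_) (sym (lookup-⊕-⊕ i)) (≤-xor (F≤G i) (G≤Y i))

  ∩-⊕-⊆ : G ∩ ((G ⊕ F) ⊕ Y) ⊆ F
  ∩-⊕-⊆ = lookup-≤⇒⊆ λ i → subst (_≤ᵇ _) (sym (lookup-∩ i)) (∧-xor-≤ (F≤G i) (G≤Y i))
    where
    lookup-∩ : ∀ i →
      lookupᵛ (G ∩ ((G ⊕ F) ⊕ Y)) i ≡ lookupᵛ G i ∧ ((lookupᵛ G i xor lookupᵛ F i) xor lookupᵛ Y i)
    lookup-∩ i = trans (lookup-zipWith _∧_ i G _) (cong (lookupᵛ G i ∧_) (lookup-⊕-⊕ i))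

⋃-least : {ps : List (Subset n)} {q : Subset n} → (∀ {p} → p ∈ ps → p ⊆ q) → ⋃ ps ⊆ q
⋃-least {ps = []} _ i∈⊥ = ⊥-elim (∉⊥ i∈⊥)
⋃-least {ps = p ∷ ps} ps⊆q i∈⋃ with x∈p∪q⁻ p (⋃ ps) i∈⋃
... | inj₁ i∈p  = ps⊆q (here refl) i∈p
... | inj₂ i∈ps = ⋃-least (ps⊆q ∘ there) i∈ps

⊆-⋃ : {ps : List (Subset n)} {p : Subset n} → p ∈ ps → p ⊆ ⋃ ps
⊆-⋃ {ps = _ ∷ ps} (here refl) = p⊆p∪q (⋃ ps)
⊆-⋃ {ps = q ∷ ps} (there p∈ps) = ⊆-trans (⊆-⋃ p∈ps) (q⊆p∪q q (⋃ ps))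

module _ (𝓕 : List (Subset n)) where

  τ-⊆ : ∀ X → τ 𝓕 X ⊆ X
  τ-⊆ X = ⋃-least (proj₂ ∘ ∈-filter⁻ (_⊆? X) {xs = 𝓕})

  ⊆-τ : ∀ {F X} → F ∈ 𝓕 → F ⊆ X → F ⊆ τ 𝓕 X
  ⊆-τ {X = X} F∈𝓕 F⊆X = ⊆-⋃ (∈-filter⁺ (_⊆? X) F∈𝓕 F⊆X)

  τ-mono : ∀ {X Y} → X ⊆ Y → τ 𝓕 X ⊆ τ 𝓕 Y
  τ-mono {X} X⊆Y = ⋃-least λ H∈ → let H∈𝓕 , H⊆X = ∈-filter⁻ (_⊆? X) H∈ in ⊆-τ H∈𝓕 (⊆-trans H⊆X X⊆Y)

  τ-⊕ : ∀ {F G Y} → F ∈ 𝓕 → F ⊆ G → τ 𝓕 Y ≡ G → τ 𝓕 ((G ⊕ F) ⊕ Y) ≡ F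
  τ-⊕ {F} {G} {Y} F∈𝓕 F⊆G refl = ⊆-antisym τX⊆F (⊆-τ F∈𝓕 (⊆-⊕ F⊆G G⊆Y))
    where
    G⊆Y : G ⊆ Y
    G⊆Y = τ-⊆ Y
    τX⊆F : τ 𝓕 ((G ⊕ F) ⊕ Y) ⊆ F
    τX⊆F i∈τX = ∩-⊕-⊆ F⊆G G⊆Y (x∈p∩q⁺ (τ-mono (⊕-⊆ʳ F⊆G G⊆Y) i∈τX , τ-⊆ _ i∈τX))

  #𝓣-antitone : ∀ {F G} → F ∈ 𝓕 → F ⊆ G → #𝓣 𝓕 G ≤ #𝓣 𝓕 F
  #𝓣-antitone {F} {G} F∈𝓕 F⊆G =
    length-filter-≤-↭ (λ X → τ 𝓕 X ≟ₛ G) (λ X → τ 𝓕 X ≟ₛ F)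
      ((G ⊕ F) ⊕_) (map-⊕-↭ (G ⊕ F)) (τ-⊕ F∈𝓕 F⊆G)

lookup-injective : {xs : List A} → Unique xs → ∀ i j → lookup xs i ≡ lookup xs j → i ≡ j
lookup-injective {xs = _ ∷ _} _ zero zero _ = refl
lookup-injective {xs = _ ∷ _} (x∉xs ∷ _) zero (suc j) x≡xⱼ = ⊥-elim (All.lookup x∉xs (∈-lookup j) x≡xⱼ)
lookup-injective {xs = _ ∷ _} (x∉xs ∷ _) (suc i) zero xᵢ≡x = ⊥-elim (All.lookup x∉xs (∈-lookup i) (sym xᵢ≡x))
lookup-injective {xs = _ ∷ _} (_ ∷ xs!) (suc i) (suc j) xᵢ≡xⱼ = cong suc (lookup-injective xs! i j xᵢ≡xⱼ)

module SortUnique (O : DecTotalOrder a ℓ₁ ℓ₂) (_≟_ : DecidableEquality (DecTotalOrder.Carrier O)) where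

  open DecTotalOrder O using (Carrier; totalOrder) renaming (_≤_ to _≼_)
  open Sort O using (sort; sort-↭; sort-↗)

  sortUnique : List Carrier → List Carrier
  sortUnique xs = sort (deduplicate _≟_ xs)

  sortUnique-! : ∀ xs → Unique (sortUnique xs)
  sortUnique-! xs =
    Permutationₛ.Unique-resp-↭ (setoid _) (↭⇒↭ₛ (↭-sym (sort-↭ _))) (deduplicate-! _≟_ xs)

  sortUnique-∈⇔ : ∀ xs {x} → x ∈ sortUnique xs ⇔ x ∈ xs
  sortUnique-∈⇔ xs = mk⇔ (∈-deduplicate⁻ _≟_ xs ∘ ∈-resp-↭ (sort-↭ _))
                         (∈-resp-↭ (↭-sym (sort-↭ _)) ∘ ∈-deduplicate⁺ _≟_)

  sortUnique-lookup-mono : ∀ xs {i j} → i ≤ᶠ j → lookup (sortUnique xs) i ≼ lookup (sortUnique xs) j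
  sortUnique-lookup-mono xs = lookup-mono-≤ totalOrder (sort-↗ _)

  sortUnique-lookup-< : ∀ xs {i j} → ¬ (lookup (sortUnique xs) j ≼ lookup (sortUnique xs) i) → i <ᶠ j
  sortUnique-lookup-< xs {i} {j} xⱼ≰xᵢ with j Finₚ.≤? i
  ... | yes j≤i = contradiction (sortUnique-lookup-mono xs j≤i) xⱼ≰xᵢ
  ... | no  j≰i = ≰⇒> j≰i

p⊆q∧∣q∣≤∣p∣⇒p≡q : {p q : Subset n} → p ⊆ q → ∣ q ∣ ≤ ∣ p ∣ → p ≡ q
p⊆q∧∣q∣≤∣p∣⇒p≡q {p = []} {[]} _ _ = refl
p⊆q∧∣q∣≤∣p∣⇒p≡q {p = outside ∷ p} {outside ∷ q} p⊆q ∣q∣≤∣p∣ =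
  cong (outside ∷_) (p⊆q∧∣q∣≤∣p∣⇒p≡q (drop-∷-⊆ p⊆q) ∣q∣≤∣p∣)
p⊆q∧∣q∣≤∣p∣⇒p≡q {p = outside ∷ p} {inside ∷ q} p⊆q ∣q∣≤∣p∣ =
  contradiction (≤-trans (s≤s (p⊆q⇒∣p∣≤∣q∣ (drop-∷-⊆ p⊆q))) ∣q∣≤∣p∣) (<-irrefl refl)
p⊆q∧∣q∣≤∣p∣⇒p≡q {p = inside ∷ p} {outside ∷ q} p⊆q _ with p⊆q here
... | ()
p⊆q∧∣q∣≤∣p∣⇒p≡q {p = inside ∷ p} {inside ∷ q} p⊆q (s≤s ∣q∣≤∣p∣) =
  cong (inside ∷_) (p⊆q∧∣q∣≤∣p∣⇒p≡q (drop-∷-⊆ p⊆q) ∣q∣≤∣p∣)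

module Labelling (𝓕 : List (Subset n)) where

  rank : Subset n → ℕ × ℕ
  rank F = #𝓣 𝓕 F , ∣ F ∣

  rankOrder : DecTotalOrder _ _ _
  rankOrder =
    On.decTotalOrder (×-decTotalOrder ≤-decTotalOrder (Flip.decTotalOrder ≤-decTotalOrder)) rank

  open DecTotalOrder rankOrder using () renaming (_≤_ to _≼_)
  open SortUnique rankOrder _≟ₛ_

  ≼⇒#𝓣-≤ : ∀ {F G} → F ≼ G → #𝓣 𝓕 F ≤ #𝓣 𝓕 G
  ≼⇒#𝓣-≤ (inj₁ (#F≤#G , _)) = #F≤#G
  ≼⇒#𝓣-≤ (inj₂ (#F≡#G , _)) = ≤-reflexive #F≡#G

  ⊆-≼⇒≡ : ∀ {F G} → F ∈ 𝓕 → F ⊆ G → F ≼ G → F ≡ G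
  ⊆-≼⇒≡ F∈𝓕 F⊆G (inj₁ (#F≤#G , #F≢#G)) =
    contradiction (≤-antisym #F≤#G (#𝓣-antitone 𝓕 F∈𝓕 F⊆G)) #F≢#G
  ⊆-≼⇒≡ F∈𝓕 F⊆G (inj₂ (_ , ∣G∣≤∣F∣)) = p⊆q∧∣q∣≤∣p∣⇒p≡q F⊆G ∣G∣≤∣F∣

  labelling : List (Subset n)
  labelling = sortUnique 𝓕

  labelling-! : Unique labelling
  labelling-! = sortUnique-! 𝓕

  labelling-∈⇔ : ∀ X → X ∈ labelling ⇔ X ∈ 𝓕
  labelling-∈⇔ _ = sortUnique-∈⇔ 𝓕

  labelling-#𝓣-mono : ∀ i j → i ≤ᶠ j → #𝓣 𝓕 (lookup labelling i) ≤ #𝓣 𝓕 (lookup labelling j)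
  labelling-#𝓣-mono i j = ≼⇒#𝓣-≤ ∘ sortUnique-lookup-mono 𝓕

  labelling-⊇⇒≤ : ∀ i j → lookup labelling j ⊆ lookup labelling i → i ≤ᶠ j
  labelling-⊇⇒≤ i j Lⱼ⊆Lᵢ with lookup labelling j ≟ₛ lookup labelling i
  ... | yes Lⱼ≡Lᵢ = Finₚ.≤-reflexive (sym (lookup-injective labelling-! j i Lⱼ≡Lᵢ))
  ... | no  Lⱼ≢Lᵢ = <⇒≤ (sortUnique-lookup-< 𝓕 (Lⱼ≢Lᵢ ∘ ⊆-≼⇒≡ Lⱼ∈𝓕 Lⱼ⊆Lᵢ))
    where
    Lⱼ∈𝓕 : lookup labelling j ∈ 𝓕
    Lⱼ∈𝓕 = Equivalence.to (labelling-∈⇔ _) (∈-lookup j)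

corollary3p6 : (n : ℕ) (𝓕 : List (Subset n)) → UnionClosed 𝓕 → ⊥ ∈ 𝓕 →
    Σ (List (Subset n)) λ L →
      Unique L
      × (∀ X → (X ∈ L) ⇔ (X ∈ 𝓕))
      × (∀ (i j : Fin (length L)) → i ≤ᶠ j → #𝓣 𝓕 (lookup L i) ≤ #𝓣 𝓕 (lookup L j))
      × (∀ (i j : Fin (length L)) → lookup L j ⊆ lookup L i → i ≤ᶠ j)
corollary3p6 n 𝓕 _ _ = labelling , labelling-! , labelling-∈⇔ , labelling-#𝓣-mono , labelling-⊇⇒≤
  where open Labelling 𝓕
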